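{- Let $p,q\in\{0,1\}^*$ be $R$-palindromes such that $pq=E(q)E(p)$ (i.e. $pq$ is an $E$-palindrome). Then there exist $c\in\{0,1\}^*$ and $i,j\in\mathbb N$ such that $p=c\,(E(c)c)^i$ and $q=(E(c)c)^jE(c)$.
   Context: $R$ is reversal; $E$ is the antimorphism $E(w_0\cdots w_n)=\overline{w_n}\cdots\overline{w_0}$ with $\overline0=1,\overline1=0$. A word $p$ is an $R$-palindrome if $R(p)=p$. -}

module Defs where

open import Data.Bool using (Bool; not)
open import Data.List using (List; []; _∷_; _++_; reverse; map)
open import Data.Nat using (ℕ; zero; suc)

-- Binary words over {0,1}, encoded as lists of Bool (false = 0, true = 1).
Word : Set
Word = List Bool

R : Word → Word
R = reverse

E : Word → Word
E w = reverse (map not w)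

_^^_ : Word → ℕ → Word
u ^^ zero = []
u ^^ suc i = u ++ (u ^^ i)

module Submission where

-- The
-- hypotheses say that p, q are palindromes with p q = bar q · bar p.  When
-- |p| ≤ |q| this forces q = t · bar p where t is an E-palindrome and
-- bar p · bar t = t · bar p; in this second kind of equation a · bar t = t · a
-- (a a palindrome, t an E-palindrome) either |t| ≤ |a| and a = t · u with
-- u · bar t = t · u again, or t = a · s and a, s is a pair of the first kind.
-- Every step shortens the pair, as in the Euclidean algorithm, and the
-- solutions of the smaller equation extend to the larger one.

open import Defs
open import Data.List using (_++_)
open import Data.Nat using (ℕ)
open import Data.Product using (Σ; _×_)
open import Relation.Binary.PropositionalEquality using (_≡_)

open import Data.Bool using (true; false; not)
open import Data.Bool.Properties using (not-involutive)
open import Data.List using (List; []; _∷_; reverse; map; length)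
open import Data.List.Properties
  using (++-assoc; ++-identityʳ; ++-cancelˡ; ∷-injectiveˡ; ∷-injectiveʳ;
         map-++; length-map; length-++; reverse-++; reverse-map; reverse-involutive)
open import Data.Nat using (zero; suc; _+_; _≤_; _<_; z≤n; s≤s; _≤?_)
open import Data.Nat.Properties using (+-comm; ≤-refl; <⇒≤; ≰⇒>; m<n+m; <-≤-trans; m+n≤o⇒m≤o)
open import Data.Product using (_,_)
open import Relation.Nullary using (yes; no)
open import Relation.Binary.PropositionalEquality
  using (refl; sym; trans; cong; cong₂; subst; module ≡-Reasoning)
open ≡-Reasoning

++-split : ∀ {A : Set} (a : List A) {b} c {d} → a ++ b ≡ c ++ d → length a ≤ length c →
  Σ (List A) λ u → c ≡ a ++ u × b ≡ u ++ d
++-split []      c       eq _         = c , refl , eq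
++-split (x ∷ a) (y ∷ c) eq (s≤s a≤c) with ++-split a c (∷-injectiveʳ eq) a≤c
... | u , c≡a++u , b≡u++d = u , cong₂ _∷_ (sym (∷-injectiveˡ eq)) c≡a++u , b≡u++d

length-split : ∀ {A : Set} {w : List A} u {v} → w ≡ u ++ v → length u + length v ≡ length w
length-split u refl = sym (length-++ u)

reverse-++-cancel : ∀ {A : Set} {x u : List A} v y →
  reverse y ≡ x → reverse (v ++ y) ≡ x ++ u → reverse v ≡ u
reverse-++-cancel {x = x} {u} v y ry≡x eq = ++-cancelˡ x _ _ (begin
  x ++ reverse v         ≡⟨ cong (_++ reverse v) (sym ry≡x) ⟩
  reverse y ++ reverse v ≡⟨ sym (reverse-++ v y) ⟩
  reverse (v ++ y)       ≡⟨ eq ⟩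
  x ++ u                 ∎)

bar : Word → Word
bar = map not

bar-involutive : ∀ w → bar (bar w) ≡ w
bar-involutive []      = refl
bar-involutive (x ∷ w) = cong₂ _∷_ (not-involutive x) (bar-involutive w)

bar-fixed⇒[] : ∀ {w} → w ≡ bar w → w ≡ []
bar-fixed⇒[] {[]}        _  = refl
bar-fixed⇒[] {true ∷ _}  ()
bar-fixed⇒[] {false ∷ _} ()

E-involutive : ∀ w → E (E w) ≡ w
E-involutive w = begin
  reverse (bar (reverse (bar w))) ≡⟨ cong reverse (reverse-map not (bar w)) ⟩
  reverse (reverse (bar (bar w))) ≡⟨ reverse-involutive _ ⟩
  bar (bar w)                     ≡⟨ bar-involutive w ⟩
  w                               ∎

E-++ : ∀ u v → E (u ++ v) ≡ E v ++ E u
E-++ u v = trans (cong reverse (map-++ not u v)) (reverse-++ (bar u) (bar v))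

E-bar : ∀ w → E (bar w) ≡ R w
E-bar w = cong reverse (bar-involutive w)

E-palindrome : ∀ {w} → R w ≡ w → E w ≡ bar w
E-palindrome {w} Rw≡w = trans (sym (reverse-map not w)) (cong bar Rw≡w)

E-++-E : ∀ d → E (d ++ E d) ≡ d ++ E d
E-++-E d = trans (E-++ d (E d)) (cong (_++ E d) (E-involutive d))

^^-+ : ∀ u i j → (u ^^ i) ++ (u ^^ j) ≡ u ^^ (i + j)
^^-+ u zero    j = refl
^^-+ u (suc i) j = trans (++-assoc u (u ^^ i) (u ^^ j)) (cong (u ++_) (^^-+ u i j))

^^-+-++ : ∀ u i j x → (u ^^ i) ++ ((u ^^ j) ++ x) ≡ (u ^^ (i + j)) ++ x
^^-+-++ u i j x = trans (sym (++-assoc (u ^^ i) (u ^^ j) x)) (cong (_++ x) (^^-+ u i j))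

^^-snoc : ∀ u n → (u ^^ n) ++ u ≡ u ^^ suc n
^^-snoc u zero    = sym (++-identityʳ u)
^^-snoc u (suc n) = trans (++-assoc u (u ^^ n) u) (cong (u ++_) (^^-snoc u n))

E-^^ : ∀ u n → E (u ^^ n) ≡ E u ^^ n
E-^^ u zero    = refl
E-^^ u (suc n) = trans (E-++ u (u ^^ n)) (trans (cong (_++ E u) (E-^^ u n)) (^^-snoc (E u) n))

rotate-^^ : ∀ x y n → x ++ ((y ++ x) ^^ n) ≡ ((x ++ y) ^^ n) ++ x
rotate-^^ x y zero    = ++-identityʳ x
rotate-^^ x y (suc n) = begin
  x ++ ((y ++ x) ++ ((y ++ x) ^^ n)) ≡⟨ sym (++-assoc x (y ++ x) _) ⟩
  (x ++ (y ++ x)) ++ ((y ++ x) ^^ n) ≡⟨ cong (_++ ((y ++ x) ^^ n)) (sym (++-assoc x y x)) ⟩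
  ((x ++ y) ++ x) ++ ((y ++ x) ^^ n) ≡⟨ ++-assoc (x ++ y) x _ ⟩
  (x ++ y) ++ (x ++ ((y ++ x) ^^ n)) ≡⟨ cong ((x ++ y) ++_) (rotate-^^ x y n) ⟩
  (x ++ y) ++ (((x ++ y) ^^ n) ++ x) ≡⟨ sym (++-assoc (x ++ y) _ x) ⟩
  ((x ++ y) ++ ((x ++ y) ^^ n)) ++ x ∎

record PalPair (p q : Word) : Set where
  constructor palPair
  field
    palindromeˡ : R p ≡ p
    palindromeʳ : R q ≡ q
    complement-swap : p ++ q ≡ bar q ++ bar p

record ConjPair (a t : Word) : Set where
  constructor conjPair
  field
    palindrome : R a ≡ a
    E-fixed : E t ≡ t
    conjugates : a ++ bar t ≡ t ++ a

PalPairForm : Word → Word → Set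
PalPairForm p q = Σ Word (λ c → Σ ℕ (λ i → Σ ℕ (λ j →
  (p ≡ c ++ ((E c ++ c) ^^ i)) × (q ≡ ((E c ++ c) ^^ j) ++ E c))))

ConjPairForm : Word → Word → Set
ConjPairForm a t = Σ Word (λ d → Σ ℕ (λ i → Σ ℕ (λ k →
  (a ≡ ((d ++ E d) ^^ i) ++ d) × (t ≡ (d ++ E d) ^^ k))))

palPair-swap : ∀ {p q} → PalPair p q → PalPair q p
palPair-swap {p} {q} (palPair Rp Rq swap) = palPair Rq Rp (begin
  q ++ p                     ≡⟨ sym (cong₂ _++_ (bar-involutive q) (bar-involutive p)) ⟩
  bar (bar q) ++ bar (bar p) ≡⟨ sym (map-++ not (bar q) (bar p)) ⟩
  bar (bar q ++ bar p)       ≡⟨ cong bar (sym swap) ⟩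
  bar (p ++ q)               ≡⟨ map-++ not p q ⟩
  bar p ++ bar q             ∎)

palPairForm-swap : ∀ {p q} → PalPairForm q p → PalPairForm p q
palPairForm-swap {p} {q} (c , i , j , q≡ , p≡) = E c , j , i , p≡′ , q≡′
  where
  p≡′ : p ≡ E c ++ ((E (E c) ++ E c) ^^ j)
  p≡′ rewrite E-involutive c = trans p≡ (sym (rotate-^^ (E c) c j))
  q≡′ : q ≡ ((E (E c) ++ E c) ^^ i) ++ E (E c)
  q≡′ rewrite E-involutive c = trans q≡ (rotate-^^ c (E c) i)

palPair⇒conjPair : ∀ {p q} → PalPair p q → length p ≤ length q →
  Σ Word λ t → q ≡ t ++ bar p × ConjPair (bar p) t
palPair⇒conjPair {p} {q} (palPair Rp Rq swap) p≤q
  with ++-split p (bar q) swap (subst (length p ≤_) (sym (length-map not q)) p≤q)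
... | t , bar-q≡p++t , q≡t++bar-p =
  t , q≡t++bar-p , conjPair (E-palindrome Rp) Et≡t (trans (sym q≡bar-p++bar-t) q≡t++bar-p)
  where
  q≡bar-p++bar-t : q ≡ bar p ++ bar t
  q≡bar-p++bar-t = trans (sym (bar-involutive q)) (trans (cong bar bar-q≡p++t) (map-++ not p t))
  Rt≡bar-t : R t ≡ bar t
  Rt≡bar-t = reverse-++-cancel t (bar p) (E-palindrome Rp)
    (trans (cong reverse (sym q≡t++bar-p)) (trans Rq q≡bar-p++bar-t))
  Et≡t : E t ≡ t
  Et≡t = trans (cong reverse (sym Rt≡bar-t)) (reverse-involutive t)

conjPairForm⇒palPairForm : ∀ {p q t} → R p ≡ p → q ≡ t ++ bar p →
  ConjPairForm (bar p) t → PalPairForm p q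
conjPairForm⇒palPairForm {p} {q} {t} Rp q≡t++bar-p (d , i , k , bar-p≡ , t≡) =
  E d , i , k + i , p≡ , q≡
  where
  w : Word
  w = d ++ E d
  p≡ : p ≡ E d ++ ((E (E d) ++ E d) ^^ i)
  p≡ rewrite E-involutive d = begin
    p                 ≡⟨ sym (trans (E-bar p) Rp) ⟩
    E (bar p)         ≡⟨ cong E bar-p≡ ⟩
    E ((w ^^ i) ++ d) ≡⟨ E-++ (w ^^ i) d ⟩
    E d ++ E (w ^^ i) ≡⟨ cong (E d ++_) (trans (E-^^ w i) (cong (_^^ i) (E-++-E d))) ⟩
    E d ++ (w ^^ i)   ∎
  q≡ : q ≡ ((E (E d) ++ E d) ^^ (k + i)) ++ E (E d)
  q≡ rewrite E-involutive d = begin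
    q                           ≡⟨ q≡t++bar-p ⟩
    t ++ bar p                  ≡⟨ cong₂ _++_ t≡ bar-p≡ ⟩
    (w ^^ k) ++ ((w ^^ i) ++ d) ≡⟨ ^^-+-++ w k i d ⟩
    (w ^^ (k + i)) ++ d         ∎

conjPair-shorten : ∀ {a t} → ConjPair a t → length t ≤ length a →
  Σ Word λ u → a ≡ t ++ u × ConjPair u t
conjPair-shorten {a} {t} (conjPair Ra Et conj) t≤a with ++-split t a (sym conj) t≤a
... | u , a≡t++u , a≡u++bar-t = u , a≡t++u , conjPair Ru Et (trans (sym a≡u++bar-t) a≡t++u)
  where
  Ru : R u ≡ u
  Ru = reverse-++-cancel u (bar t) Et (trans (cong reverse (sym a≡u++bar-t)) (trans Ra a≡t++u))

conjPairForm-prepend : ∀ {a t u} → a ≡ t ++ u → ConjPairForm u t → ConjPairForm a t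
conjPairForm-prepend a≡t++u (d , i , k , u≡ , t≡) =
  d , k + i , k , trans a≡t++u (trans (cong₂ _++_ t≡ u≡) (^^-+-++ (d ++ E d) k i d)) , t≡

conjPair⇒palPair : ∀ {a t} → ConjPair a t → length a ≤ length t →
  Σ Word λ s → t ≡ a ++ s × PalPair a s
conjPair⇒palPair {a} {t} (conjPair Ra Et conj) a≤t with ++-split a t conj a≤t
... | s , t≡a++s , bar-t≡s++a = s , t≡a++s , palPair Ra Rs swap
  where
  Rs : R s ≡ s
  Rs = reverse-++-cancel s a Ra (trans (cong reverse (sym bar-t≡s++a)) (trans Et t≡a++s))
  swap : a ++ s ≡ bar s ++ bar a
  swap = begin
    a ++ s         ≡⟨ sym t≡a++s ⟩
    t              ≡⟨ sym (bar-involutive t) ⟩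
    bar (bar t)    ≡⟨ cong bar bar-t≡s++a ⟩
    bar (s ++ a)   ≡⟨ map-++ not s a ⟩
    bar s ++ bar a ∎

palPairForm⇒conjPairForm : ∀ {a s t} → t ≡ a ++ s → PalPairForm a s → ConjPairForm a t
palPairForm⇒conjPairForm {a} {s} {t} t≡a++s (c , i , j , a≡ , s≡) =
  c , i , suc (i + j) , trans a≡ (rotate-^^ c (E c) i) , t≡
  where
  v : Word
  v = E c ++ c
  t≡ : t ≡ (c ++ E c) ^^ suc (i + j)
  t≡ = begin
    t                                     ≡⟨ t≡a++s ⟩
    a ++ s                                ≡⟨ cong₂ _++_ a≡ s≡ ⟩
    (c ++ (v ^^ i)) ++ ((v ^^ j) ++ E c)  ≡⟨ ++-assoc c _ _ ⟩
    c ++ ((v ^^ i) ++ ((v ^^ j) ++ E c))  ≡⟨ cong (c ++_) (^^-+-++ v i j (E c)) ⟩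
    c ++ ((v ^^ (i + j)) ++ E c)          ≡⟨ sym (++-assoc c _ (E c)) ⟩
    (c ++ (v ^^ (i + j))) ++ E c          ≡⟨ cong (_++ E c) (rotate-^^ c (E c) (i + j)) ⟩
    (((c ++ E c) ^^ (i + j)) ++ c) ++ E c ≡⟨ ++-assoc _ c (E c) ⟩
    ((c ++ E c) ^^ (i + j)) ++ (c ++ E c) ≡⟨ ^^-snoc (c ++ E c) (i + j) ⟩
    (c ++ E c) ^^ suc (i + j)             ∎

ConjSolvable : ℕ → Set
ConjSolvable n = ∀ {a t} → length t + length a < n → ConjPair a t → ConjPairForm a t

palPair-form≤ : ∀ {n p q} → ConjSolvable n → length p + length q ≤ n → length p ≤ length q →
  PalPair p q → PalPairForm p q
palPair-form≤ {p = []} _ _ _ (palPair _ _ swap) =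
  [] , 0 , 0 , refl , bar-fixed⇒[] (trans swap (++-identityʳ _))
palPair-form≤ {n} {p@(_ ∷ _)} {q} solve size p≤q pq@(palPair Rp _ _)
  with palPair⇒conjPair pq p≤q
... | t , q≡t++bar-p , tp = conjPairForm⇒palPairForm Rp q≡t++bar-p (solve smaller tp)
  where
  smaller : length t + length (bar p) < n
  smaller = subst (_< n) (sym (length-split t q≡t++bar-p))
    (<-≤-trans (m<n+m (length q) (s≤s z≤n)) size)

palPair-form : ∀ {n p q} → ConjSolvable n → length p + length q ≤ n → PalPair p q → PalPairForm p q
palPair-form {n} {p} {q} solve size pq with length p ≤? length q
... | yes p≤q = palPair-form≤ solve size p≤q pq
... | no p≰q = palPairForm-swap
  (palPair-form≤ solve (subst (_≤ n) (+-comm (length p) (length q)) size)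
    (<⇒≤ (≰⇒> p≰q)) (palPair-swap pq))

conjPair-form : ∀ n → ConjSolvable n
conjPair-form zero ()
conjPair-form (suc n) {a} {[]} _ _ = a , 0 , 0 , refl , refl
conjPair-form (suc n) {a} {t@(_ ∷ _)} (s≤s size) ta with length t ≤? length a
... | yes t≤a with conjPair-shorten ta t≤a
...   | u , a≡t++u , ut = conjPairForm-prepend a≡t++u (conjPair-form n smaller ut)
  where
  smaller : length t + length u < n
  smaller = subst (_< n) (sym (length-split t a≡t++u))
    (<-≤-trans (m<n+m (length a) (s≤s z≤n)) size)
conjPair-form (suc n) {a} {t@(_ ∷ _)} (s≤s size) ta | no t≰a
  with conjPair⇒palPair ta (<⇒≤ (≰⇒> t≰a))
... | s , t≡a++s , as = palPairForm⇒conjPairForm t≡a++s (palPair-form (conjPair-form n) bound as)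
  where
  bound : length a + length s ≤ n
  bound = subst (_≤ n) (sym (length-split a t≡a++s)) (m+n≤o⇒m≤o (length t) size)

mainTheorem8 : (p q : Word) → R p ≡ p → R q ≡ q → p ++ q ≡ E q ++ E p →
    Σ Word (λ c → Σ ℕ (λ i → Σ ℕ (λ j →
    (p ≡ c ++ ((E c ++ c) ^^ i)) × (q ≡ ((E c ++ c) ^^ j) ++ E c))))
mainTheorem8 p q Rp Rq pq≡EqEp =
  palPair-form (conjPair-form (length p + length q)) ≤-refl
    (palPair Rp Rq (trans pq≡EqEp (cong₂ _++_ (E-palindrome Rq) (E-palindrome Rp))))
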